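{- Let $k\ge1$ and let $\{H_n\}$ be the PLRS generated by the $L=k+2$ coefficients $[\underbrace{1,\ldots,1}_{k},0,4]$. Then $\{H_n\}$ is incomplete; moreover, $H_n\le 1+\sum_{i=1}^{n-1}H_i$ for all $1\le n\le 2k+2$, while $H_{2k+3}>1+\sum_{i=1}^{2k+2}H_i$ (i.e., Brown's criterion first fails at term $2k+3=2L-1$).
   Context: A positive linear recurrence sequence (PLRS) generated by coefficients $[c_1,\ldots,c_L]$ (with $L\ge1$, $c_i$ nonnegative integers, $c_1>0$, $c_L>0$) is the sequence $\{H_n\}_{n\ge1}$ defined by $H_1=1$; for $1\le n<L$, $H_{n+1}=c_1H_n+c_2H_{n-1}+\cdots+c_nH_1+1$; and for $n\ge L$, $H_{n+1}=c_1H_n+\cdots+c_LH_{n+1-L}$. A sequence of positive integers is complete if every positive integer is a sum of distinct terms of the sequence; otherwise it is incomplete. -}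

module Defs where

open import Data.Nat using (ℕ; zero; suc; _+_; _*_; _≤_; _<_)
open import Data.Nat.Properties using (_<?_)
open import Data.List using (List; []; _∷_; length; replicate; _++_; map)
open import Data.Nat.ListAction using (sum)
open import Data.List.Relation.Unary.All using (All)
open import Data.List.Relation.Unary.Unique.Propositional using (Unique)
open import Data.Product using (Σ; _×_)
open import Relation.Nullary using (¬_; yes; no)
open import Relation.Binary.PropositionalEquality using (_≡_)

-- dot product of coefficients c₁,c₂,… with previous terms H_n, H_{n-1}, …
-- (truncated at the shorter list)
dot : List ℕ → List ℕ → ℕ
dot [] _ = 0
dot _ [] = 0
dot (c ∷ cs) (h ∷ hs) = c * h + dot cs hs

-- revTerms cs n = [H_n, H_{n-1}, …, H_1]  (the first n terms, reversed)
revTerms : List ℕ → ℕ → List ℕ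
revTerms cs zero = []
revTerms cs (suc zero) = 1 ∷ []
revTerms cs (suc (suc n)) with revTerms cs (suc n)
... | prev with suc n <? length cs
...   | yes _ = (dot cs prev + 1) ∷ prev
...   | no  _ = dot cs prev ∷ prev

-- H cs n = H_n for n ≥ 1 (H cs 0 = 0 is a junk value, never used)
H : List ℕ → ℕ → ℕ
H cs n with revTerms cs n
... | [] = 0
... | h ∷ _ = h

sumH : List ℕ → ℕ → ℕ
sumH cs zero = 0
sumH cs (suc m) = H cs (suc m) + sumH cs m

Complete : (ℕ → ℕ) → Set
Complete a = ∀ (m : ℕ) → 1 ≤ m →
  Σ (List ℕ) λ is → Unique is × All (1 ≤_) is × sum (map a is) ≡ m

coeffs : ℕ → List ℕ
coeffs k = replicate k 1 ++ (0 ∷ 4 ∷ [])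

-- Write S n = H 1 + ⋯ + H n. While n ≤ k the first n + 1 coefficients are all 1, so
-- H (n + 1) = S n + 1, i.e. S n + 1 = 2 ^ n. The coefficient 0 at position k + 1 drops H 1 = 1,
-- so H (k + 2) = S (k + 1). Beyond that, with n = k + m, the recurrence gives
-- H (n + 1) = S n − S m + 4 H (m − 1), so H (n + 1) − S n is the excess 4 H (m − 1) − S m, which
-- is 2 ^ m − (2 ^ m − 1) = 1 for m ≤ k + 1 but 2 for m = k + 2, where the missing 1 in H (k + 2)
-- shows up. Hence Brown's criterion holds up to index 2k + 2 and fails at 2k + 3. As c₁ = 1 the
-- sequence is nondecreasing, so 1 + S (2k + 2) exceeds the sum of all earlier terms and is
-- smaller than every later one: it is not a sum of distinct terms.

module Submission where

open import Defs
open import Data.Nat using (ℕ; zero; suc; _+_; _*_; _^_; _∸_; _≤_; _<_; z≤n; s≤s)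
open import Data.Nat.Properties
open import Data.Nat.ListAction using (sum)
open import Data.Nat.ListAction.Properties using (sum-↭)
open import Data.Nat.Tactic.RingSolver using (solve-∀)
open import Data.List using (List; []; _∷_; length; replicate; _++_; map)
open import Data.List.Membership.Propositional using (_∈_)
open import Data.List.Membership.Propositional.Properties using (∈-∃++; ∈-map⁺)
open import Data.List.Membership.DecPropositional _≟_ using (_∈?_)
open import Data.List.Relation.Unary.All as All using (All; _∷_)
open import Data.List.Relation.Unary.All.Properties using (¬Any⇒All¬)
open import Data.List.Relation.Unary.Any using (here; there)
open import Data.List.Relation.Unary.Unique.Propositional using (Unique; _∷_)
open import Data.List.Relation.Binary.Permutation.Propositional using (_↭_; ↭⇒↭ₛ)
open import Data.List.Relation.Binary.Permutation.Propositional.Properties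
  using (All-resp-↭; shift; map⁺)
open import Relation.Binary.PropositionalEquality
open import Data.List.Relation.Binary.Permutation.Setoid.Properties (setoid ℕ)
  using (Unique-resp-↭)
open import Data.Product using (_×_; _,_)
open import Data.Sum using (inj₁; inj₂)
open import Function using (_∘_)
open import Relation.Nullary using (¬_; yes; no; contradiction)

revTerms-suc : ∀ cs n → revTerms cs (suc n) ≡ H cs (suc n) ∷ revTerms cs n
revTerms-suc cs zero = refl
revTerms-suc cs (suc n) with revTerms cs (suc n) | suc n <? length cs
... | prev | yes _ = refl
... | prev | no _ = refl

H-init : ∀ cs n → 1 ≤ n → n < length cs → H cs (suc n) ≡ dot cs (revTerms cs n) + 1
H-init cs (suc n) _ n<L with revTerms cs (suc n) | suc n <? length cs
... | prev | yes _ = refl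
... | prev | no n≮L = contradiction n<L n≮L

H-rec : ∀ cs n → 1 ≤ n → length cs ≤ n → H cs (suc n) ≡ dot cs (revTerms cs n)
H-rec cs (suc n) _ L≤n with revTerms cs (suc n) | suc n <? length cs
... | prev | yes n<L = contradiction L≤n (<⇒≱ n<L)
... | prev | no _ = refl

dot≤H : ∀ cs n → 1 ≤ n → dot cs (revTerms cs n) ≤ H cs (suc n)
dot≤H cs n 1≤n with n <? length cs
... | yes n<L = ≤-trans (m≤m+n _ 1) (≤-reflexive (sym (H-init cs n 1≤n n<L)))
... | no n≮L = ≤-reflexive (sym (H-rec cs n 1≤n (≮⇒≥ n≮L)))

H-nondecreasing : ∀ c cs n → H (suc c ∷ cs) (suc n) ≤ H (suc c ∷ cs) (suc (suc n))
H-nondecreasing c cs n = begin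
  H ds (suc n)                                       ≤⟨ m≤n*m _ (suc c) ⟩
  suc c * H ds (suc n)                               ≤⟨ m≤m+n _ _ ⟩
  suc c * H ds (suc n) + dot cs (revTerms ds n)      ≡⟨ cong (dot ds) (revTerms-suc ds n) ⟨
  dot ds (revTerms ds (suc n))                       ≤⟨ dot≤H ds (suc n) (s≤s z≤n) ⟩
  H ds (suc (suc n))                                 ∎
  where
  open ≤-Reasoning
  ds : List ℕ
  ds = suc c ∷ cs

dot-ones : ∀ cs ys j → dot (replicate j 1 ++ ys) (revTerms cs j) ≡ sumH cs j
dot-ones cs [] zero = refl
dot-ones cs (_ ∷ _) zero = refl
dot-ones cs ys (suc j) rewrite revTerms-suc cs j =
  cong₂ _+_ (*-identityˡ (H cs (suc j))) (dot-ones cs ys j)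

dot-ones++ : ∀ cs ys j m →
  dot (replicate j 1 ++ ys) (revTerms cs (j + m)) + sumH cs m ≡ sumH cs (j + m) + dot ys (revTerms cs m)
dot-ones++ cs ys zero m = +-comm _ (sumH cs m)
dot-ones++ cs ys (suc j) m = begin
  dot (1 ∷ replicate j 1 ++ ys) (revTerms cs (suc (j + m))) + sumH cs m
    ≡⟨ cong (λ t → dot (1 ∷ replicate j 1 ++ ys) t + sumH cs m) (revTerms-suc cs (j + m)) ⟩
  1 * h + d + sumH cs m         ≡⟨ cong (λ x → x + d + sumH cs m) (*-identityˡ h) ⟩
  h + d + sumH cs m             ≡⟨ +-assoc h d _ ⟩
  h + (d + sumH cs m)           ≡⟨ cong (h +_) (dot-ones++ cs ys j m) ⟩
  h + (sumH cs (j + m) + e)     ≡⟨ +-assoc h _ e ⟨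
  sumH cs (suc j + m) + e       ∎
  where
  open ≡-Reasoning
  h d e : ℕ
  h = H cs (suc (j + m))
  d = dot (replicate j 1 ++ ys) (revTerms cs (j + m))
  e = dot ys (revTerms cs m)

partialSum : (ℕ → ℕ) → ℕ → ℕ
partialSum a zero = 0
partialSum a (suc n) = a (suc n) + partialSum a n

sumH≡partialSum : ∀ cs n → sumH cs n ≡ partialSum (H cs) n
sumH≡partialSum cs zero = refl
sumH≡partialSum cs (suc n) = cong (H cs (suc n) +_) (sumH≡partialSum cs n)

nondecreasing⇒monotone : ∀ (a : ℕ → ℕ) → (∀ n → a (suc n) ≤ a (suc (suc n))) →
  ∀ {m n} → m ≤ n → a (suc m) ≤ a (suc n)
nondecreasing⇒monotone a step {n = zero} z≤n = ≤-refl
nondecreasing⇒monotone a step {n = suc n} m≤1+n with m≤n⇒m<n∨m≡n m≤1+n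
... | inj₁ m<1+n = ≤-trans (nondecreasing⇒monotone a step (≤-pred m<1+n)) (step n)
... | inj₂ refl = ≤-refl

∈⇒≤sum : ∀ {n ns} → n ∈ ns → n ≤ sum ns
∈⇒≤sum {ns = n ∷ ns} (here refl) = m≤m+n n (sum ns)
∈⇒≤sum {ns = m ∷ ns} (there n∈ns) = ≤-trans (∈⇒≤sum n∈ns) (m≤n+m _ m)

All≤-pred : ∀ {N is} → All (suc N ≢_) is → All (_≤ suc N) is → All (_≤ N) is
All≤-pred ≢N+1 ≤N+1 = All.zipWith (λ (i≢ , i≤) → ≤-pred (≤∧≢⇒< i≤ (i≢ ∘ sym))) (≢N+1 , ≤N+1)

sum-distinct≤partialSum : ∀ a N {is} → Unique is → All (1 ≤_) is → All (_≤ N) is →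
  sum (map a is) ≤ partialSum a N
sum-distinct≤partialSum a zero {[]} _ _ _ = z≤n
sum-distinct≤partialSum a zero {i ∷ _} _ (1≤i ∷ _) (i≤0 ∷ _) = contradiction (≤-trans 1≤i i≤0) λ ()
sum-distinct≤partialSum a (suc N) {is} u pos bnd with suc N ∈? is
... | no N+1∉is =
  ≤-trans (sum-distinct≤partialSum a N u pos (All≤-pred (¬Any⇒All¬ is N+1∉is) bnd)) (m≤n+m _ _)
... | yes N+1∈is with ∈-∃++ N+1∈is
... | xs , ys , refl with Unique-resp-↭ (↭⇒↭ₛ (shift (suc N) xs ys)) u
... | ≢N+1 ∷ u′ = begin
  sum (map a (xs ++ suc N ∷ ys))     ≡⟨ sum-↭ (map⁺ a σ) ⟩
  a (suc N) + sum (map a (xs ++ ys)) ≤⟨ +-monoʳ-≤ (a (suc N)) (sum-distinct≤partialSum a N u′ pos′ bnd′) ⟩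
  partialSum a (suc N)               ∎
  where
  open ≤-Reasoning
  σ : xs ++ suc N ∷ ys ↭ suc N ∷ xs ++ ys
  σ = shift (suc N) xs ys
  pos′ : All (1 ≤_) (xs ++ ys)
  pos′ = All.tail (All-resp-↭ σ pos)
  bnd′ : All (_≤ N) (xs ++ ys)
  bnd′ = All≤-pred ≢N+1 (All.tail (All-resp-↭ σ bnd))

¬Complete-if-gap : ∀ a N → (∀ n → a (suc n) ≤ a (suc (suc n))) →
  1 + partialSum a N < a (suc N) → ¬ Complete a
¬Complete-if-gap a N step gap complete with complete (1 + partialSum a N) (s≤s z≤n)
... | is , u , pos , sum≡ =
  1+n≰n (subst (_≤ partialSum a N) sum≡ (sum-distinct≤partialSum a N u pos bnd))
  where
  index≤N : ∀ {i} → 1 ≤ i → a i ≤ 1 + partialSum a N → i ≤ N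
  index≤N {suc i} _ ai≤ with suc i ≤? N
  ... | yes i<N = i<N
  ... | no i≮N = contradiction (≤-trans (nondecreasing⇒monotone a step (≮⇒≥ i≮N)) ai≤) (<⇒≱ gap)
  bnd : All (_≤ N) is
  bnd = All.tabulate λ i∈is →
    index≤N (All.lookup pos i∈is) (subst (_ ≤_) sum≡ (∈⇒≤sum (∈-map⁺ a i∈is)))

coeffs-+ : ∀ j d → coeffs (j + d) ≡ replicate j 1 ++ coeffs d
coeffs-+ zero d = refl
coeffs-+ (suc j) d = cong (1 ∷_) (coeffs-+ j d)

length-coeffs : ∀ k → length (coeffs k) ≡ 2 + k
length-coeffs zero = refl
length-coeffs (suc k) = cong suc (length-coeffs k)

2*k+2≡k+[2+k] : ∀ k → 2 * k + 2 ≡ k + (2 + k)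
2*k+2≡k+[2+k] = solve-∀

module _ (k : ℕ) where

  private
    cs : List ℕ
    cs = coeffs k

  H≡sumH+1 : ∀ n → n ≤ k → H cs (suc n) ≡ sumH cs n + 1
  H≡sumH+1 zero _ = refl
  H≡sumH+1 (suc n) n<k with m≤n⇒∃[o]m+o≡n n<k
  ... | d , n+d≡k = begin
    H cs (suc (suc n))                                  ≡⟨ H-init cs (suc n) (s≤s z≤n) n<L ⟩
    dot cs (revTerms cs (suc n)) + 1                    ≡⟨ cong (λ c → dot c (revTerms cs (suc n)) + 1) split ⟩
    dot (replicate (suc n) 1 ++ coeffs d) (revTerms cs (suc n)) + 1
                                                        ≡⟨ cong (_+ 1) (dot-ones cs (coeffs d) (suc n)) ⟩
    sumH cs (suc n) + 1                                 ∎
    where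
    open ≡-Reasoning
    split : cs ≡ replicate (suc n) 1 ++ coeffs d
    split = trans (cong coeffs (sym n+d≡k)) (coeffs-+ (suc n) d)
    n<L : suc n < length cs
    n<L = subst (suc n <_) (sym (length-coeffs k)) (m≤n⇒m≤1+n (s≤s n<k))

  sumH+1≡2^ : ∀ n → n ≤ suc k → sumH cs n + 1 ≡ 2 ^ n
  sumH+1≡2^ zero _ = refl
  sumH+1≡2^ (suc n) (s≤s n≤k) = begin
    H cs (suc n) + s + 1    ≡⟨ cong (λ h → h + s + 1) (H≡sumH+1 n n≤k) ⟩
    s + 1 + s + 1           ≡⟨ doubling s ⟩
    2 * (s + 1)             ≡⟨ cong (2 *_) (sumH+1≡2^ n (m≤n⇒m≤1+n n≤k)) ⟩
    2 ^ suc n               ∎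
    where
    open ≡-Reasoning
    s : ℕ
    s = sumH cs n
    doubling : ∀ x → x + 1 + x + 1 ≡ 2 * (x + 1)
    doubling = solve-∀

  H≡2^ : ∀ n → n ≤ k → H cs (suc n) ≡ 2 ^ n
  H≡2^ n n≤k = trans (H≡sumH+1 n n≤k) (sumH+1≡2^ n (m≤n⇒m≤1+n n≤k))

  4*H≡2^[2+n] : ∀ n → n ≤ k → 4 * H cs (suc n) ≡ 2 ^ (2 + n)
  4*H≡2^[2+n] n n≤k = trans (cong (4 *_) (H≡2^ n n≤k)) (*-assoc 2 2 (2 ^ n))

  H-pivot : H cs (suc (k + 1)) ≡ sumH cs (k + 1)
  H-pivot = begin
    H cs (suc (k + 1))                        ≡⟨ H-init cs (k + 1) (m≤n+m 1 k) k+1<L ⟩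
    dot cs (revTerms cs (k + 1)) + sumH cs 1  ≡⟨ dot-ones++ cs (0 ∷ 4 ∷ []) k 1 ⟩
    sumH cs (k + 1) + 0                       ≡⟨ +-identityʳ _ ⟩
    sumH cs (k + 1)                           ∎
    where
    open ≡-Reasoning
    k+1<L : k + 1 < length cs
    k+1<L = subst₂ _<_ (+-comm 1 k) (sym (length-coeffs k)) ≤-refl

  H-tail : ∀ p →
    H cs (suc (k + (2 + p))) + sumH cs (2 + p) ≡ sumH cs (k + (2 + p)) + 4 * H cs (suc p)
  H-tail p = begin
    H cs (suc n) + sumH cs (2 + p)                      ≡⟨ cong (_+ sumH cs (2 + p)) (H-rec cs n 1≤n L≤n) ⟩
    dot cs (revTerms cs n) + sumH cs (2 + p)            ≡⟨ dot-ones++ cs (0 ∷ 4 ∷ []) k (2 + p) ⟩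
    sumH cs n + dot (0 ∷ 4 ∷ []) (revTerms cs (2 + p))  ≡⟨ cong (sumH cs n +_) dot-04 ⟩
    sumH cs n + 4 * H cs (suc p)                        ∎
    where
    open ≡-Reasoning
    n : ℕ
    n = k + (2 + p)
    1≤n : 1 ≤ n
    1≤n = ≤-trans (s≤s z≤n) (m≤n+m (2 + p) k)
    L≤n : length cs ≤ n
    L≤n = subst (_≤ n) (sym (trans (length-coeffs k) (+-comm 2 k))) (+-monoʳ-≤ k (m≤m+n 2 p))
    dot-04 : dot (0 ∷ 4 ∷ []) (revTerms cs (2 + p)) ≡ 4 * H cs (suc p)
    dot-04 rewrite revTerms-suc cs (suc p) | revTerms-suc cs p = +-identityʳ _

  H-tail-excess : ∀ p e → sumH cs (2 + p) + e ≡ 4 * H cs (suc p) →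
    H cs (suc (k + (2 + p))) ≡ sumH cs (k + (2 + p)) + e
  H-tail-excess p e excess = +-cancelʳ-≡ (sumH cs (2 + p)) _ _ (begin
    H cs (suc n) + s              ≡⟨ H-tail p ⟩
    sumH cs n + 4 * H cs (suc p)  ≡⟨ cong (sumH cs n +_) excess ⟨
    sumH cs n + (s + e)           ≡⟨ cong (sumH cs n +_) (+-comm s e) ⟩
    sumH cs n + (e + s)           ≡⟨ +-assoc (sumH cs n) e s ⟨
    sumH cs n + e + s             ∎)
    where
    open ≡-Reasoning
    n s : ℕ
    n = k + (2 + p)
    s = sumH cs (2 + p)

  excess-below : ∀ p → p < k → sumH cs (2 + p) + 1 ≡ 4 * H cs (suc p)
  excess-below p p<k = trans (sumH+1≡2^ (2 + p) (s≤s p<k)) (sym (4*H≡2^[2+n] p (<⇒≤ p<k)))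

  excess-top : sumH cs (2 + k) + 2 ≡ 4 * H cs (suc k)
  excess-top = begin
    H cs (2 + k) + s + 2  ≡⟨ cong (λ h → h + s + 2) pivot ⟩
    s + s + 2             ≡⟨ doubling s ⟩
    2 * (s + 1)           ≡⟨ cong (2 *_) (sumH+1≡2^ (1 + k) ≤-refl) ⟩
    2 ^ (2 + k)           ≡⟨ 4*H≡2^[2+n] k ≤-refl ⟨
    4 * H cs (suc k)      ∎
    where
    open ≡-Reasoning
    s : ℕ
    s = sumH cs (1 + k)
    pivot : H cs (2 + k) ≡ s
    pivot = subst (λ n → H cs (suc n) ≡ sumH cs n) (+-comm k 1) H-pivot
    doubling : ∀ x → x + x + 2 ≡ 2 * (x + 1)
    doubling = solve-∀

  H≤1+sumH : ∀ n → n < k + (2 + k) → H cs (suc n) ≤ 1 + sumH cs n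
  H≤1+sumH n n<N with n ≤? k
  ... | yes n≤k = ≤-reflexive (trans (H≡sumH+1 n n≤k) (+-comm _ 1))
  ... | no n≰k with m≤n⇒∃[o]m+o≡n (<⇒≤ (≰⇒> n≰k))
  ... | zero , k+0≡n = contradiction (≤-reflexive (trans (sym k+0≡n) (+-identityʳ k))) n≰k
  ... | suc zero , refl = ≤-trans (≤-reflexive H-pivot) (n≤1+n _)
  ... | suc (suc p) , refl = ≤-reflexive (trans (H-tail-excess p 1 (excess-below p p<k)) (+-comm _ 1))
    where
    p<k : p < k
    p<k = ≤-pred (≤-pred (+-cancelˡ-< k (2 + p) (2 + k) n<N))

  gap : 1 + sumH cs (k + (2 + k)) < H cs (suc (k + (2 + k)))
  gap = subst (1 + sumH cs (k + (2 + k)) <_) (sym (H-tail-excess k 2 excess-top))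
              (≤-reflexive (+-comm 2 (sumH cs (k + (2 + k)))))

  brown-criterion : ∀ n → 1 ≤ n → n ≤ 2 * k + 2 → H cs n ≤ 1 + sumH cs (n ∸ 1)
  brown-criterion (suc n) _ n<2k+2 = H≤1+sumH n (subst (suc n ≤_) (2*k+2≡k+[2+k] k) n<2k+2)

  brown-fails : 1 + sumH cs (2 * k + 2) < H cs (2 * k + 3)
  brown-fails = subst₂ (λ a b → 1 + sumH cs a < H cs b) (sym (2*k+2≡k+[2+k] k)) (sym 2*k+3≡) gap
    where
    2*k+3≡ : 2 * k + 3 ≡ suc (k + (2 + k))
    2*k+3≡ = trans (+-suc (2 * k) 2) (cong suc (2*k+2≡k+[2+k] k))

coeffs-incomplete : ∀ k → 1 ≤ k → ¬ Complete (H (coeffs k))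
coeffs-incomplete (suc k) _ =
  ¬Complete-if-gap (H cs) N (H-nondecreasing 0 (coeffs k))
    (subst (λ s → 1 + s < H cs (suc N)) (sumH≡partialSum cs N) (gap (suc k)))
  where
  cs : List ℕ
  cs = coeffs (suc k)
  N : ℕ
  N = suc k + (2 + suc k)

mainTheorem11 : ∀ (k : ℕ) → 1 ≤ k →
    ¬ Complete (H (coeffs k))
    × (∀ (n : ℕ) → 1 ≤ n → n ≤ 2 * k + 2 → H (coeffs k) n ≤ 1 + sumH (coeffs k) (n ∸ 1))
    × (1 + sumH (coeffs k) (2 * k + 2) < H (coeffs k) (2 * k + 3))
mainTheorem11 k 1≤k = coeffs-incomplete k 1≤k , brown-criterion k , brown-fails k
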